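{- Let $G$ be a connected unicyclic graph of order $n$. If $n$ is even then $\Gamma(G)\geq n/2$, and if $n$ is odd then $\Gamma(G)\geq (n-1)/2$.
   Context: All graphs are finite, simple and undirected. A graph is unicyclic if it is connected and contains exactly one cycle. A set $D\subseteq V(G)$ is dominating if every vertex is in $D$ or adjacent to a vertex of $D$; it is minimal if no proper subset is dominating. $\Gamma(G)$ is the maximum cardinality of a minimal dominating set of $G$. -}

module Defs where

open import Data.Nat using (ℕ; suc; _+_)
open import Data.Fin using (Fin; toℕ)
open import Data.Fin.Subset using (Subset; _∈_; _⊂_)
open import Data.Product using (Σ; _×_; ∃)
open import Data.Sum using (_⊎_)
open import Relation.Nullary using (¬_)
open import Relation.Binary.PropositionalEquality using (_≡_; _≢_)
open import Function.Definitions using (Injective)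

record Graph (n : ℕ) : Set₁ where
  field
    Adj   : Fin n → Fin n → Set
    sym   : ∀ {u v} → Adj u v → Adj v u
    irrefl : ∀ {u} → ¬ Adj u u
open Graph public

data Walk {n : ℕ} (G : Graph n) : Fin n → Fin n → Set where
  here : ∀ {u} → Walk G u u
  step : ∀ {u v w} → Adj G u v → Walk G v w → Walk G u w

Connected : ∀ {n} → Graph n → Set
Connected G = ∀ u v → Walk G u v

CycSucc : ∀ {k} → Fin k → Fin k → Set
CycSucc {k} i j = (toℕ j ≡ suc (toℕ i)) ⊎ ((suc (toℕ i) ≡ k) × (toℕ j ≡ 0))

record Cycle {n : ℕ} (G : Graph n) : Set where
  field
    m     : ℕ
    vs    : Fin (3 + m) → Fin n
    inj   : Injective _≡_ _≡_ vs
    edges : ∀ i j → CycSucc i j → Adj G (vs i) (vs j)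
open Cycle public

CycleEdge : ∀ {n} {G : Graph n} → Cycle G → Fin n → Fin n → Set
CycleEdge C u v =
  ∃ λ i → ∃ λ j → CycSucc i j ×
    (((vs C i ≡ u) × (vs C j ≡ v)) ⊎ ((vs C i ≡ v) × (vs C j ≡ u)))

-- Two cycles are the same cycle (subgraph) iff they have the same edge set.
SameCycle : ∀ {n} {G : Graph n} → Cycle G → Cycle G → Set
SameCycle C D = ∀ u v → (CycleEdge C u v → CycleEdge D u v) × (CycleEdge D u v → CycleEdge C u v)

Unicyclic : ∀ {n} → Graph n → Set
Unicyclic G = Connected G × Cycle G × (∀ (C D : Cycle G) → SameCycle C D)

Dominating : ∀ {n} → Graph n → Subset n → Set
Dominating G D = ∀ v → (v ∈ D) ⊎ (∃ λ u → (u ∈ D) × Adj G u v)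

MinimalDominating : ∀ {n} → Graph n → Subset n → Set
MinimalDominating G D = Dominating G D × (∀ D′ → D′ ⊂ D → ¬ Dominating G D′)

-- Let ab be an edge of the unique cycle C and grow a spanning tree T of G − ab from a. Every edge
-- of G − ab is an edge of T: otherwise it would close, with a path of T, a cycle of G missing ab,
-- i.e. a second cycle. Colouring vertices by the parity of their depth in T, every edge of G other
-- than ab joins different colours, so each colour class with a removed is independent in G. The two
-- sets cover n − 1 vertices, so one of them has at least ⌊n/2⌋ ≥ ⌊(n−1)/2⌋ elements. Adjacency in G
-- is decidable (an edge is ab or a tree edge), so this set extends greedily to a maximal independent
-- set, which is a minimal dominating set.

module Submission where

open import Defs
open import Data.Nat using (ℕ; _≤_; _∸_; _/_; _%_)
open import Data.Fin.Subset using (∣_∣)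
open import Data.Product using (∃; _×_)
open import Relation.Binary.PropositionalEquality using (_≡_)

open import Data.Bool using (Bool; true; false; not)
open import Data.Bool.Properties using (not-¬; ¬-not)
open import Data.Empty using (⊥-elim)
open import Data.Fin using (Fin; zero; suc; inject₁; fromℕ; toℕ)
open import Data.Fin.Properties using (any?; _≟_; toℕ-inject₁; toℕ-fromℕ; fromℕ≢inject₁)
import Data.Fin.Properties as Fin
open import Data.Fin.Subset using (Subset; _∈_; _∉_; _⊆_; _⊂_; ∁; _-_; _∪_; ⁅_⁆; inside; outside)
open import Data.Fin.Subset.Properties
  using (_∈?_; p⊆q⇒∣p∣≤∣q∣; ∣∁p∣≡n∸∣p∣; ∣p∣≤n; x∈∁p⇒x∉p; x∈p⇒x∉∁p; x∈p∧x≢y⇒x∈p-y;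
         p─q⊆p; ∪-identityʳ; x∈p∪q⁻; x∈p∪q⁺; p⊆p∪q; x∈⁅x⁆; x∈⁅y⁆⇒x≡y)
open import Data.List using (List; []; _∷_; allFin)
open import Data.List.Membership.Propositional.Properties using (∈-allFin)
open import Data.List.Relation.Unary.All as All using (All; []; _∷_)
open import Data.Nat using (zero; suc; _+_; _*_; s≤s)
open import Data.Nat.DivMod using (m/n*n≤m; /-monoˡ-≤)
open import Data.Nat.Properties
  using (suc-injective; ≤-refl; ≤-trans; n≤1+n; 1+n≰n; ≰⇒>; +-suc; +-mono-≤;
         +-identityʳ; *-comm; m∸n≤m; m+[n∸m]≡n; _≤?_; module ≤-Reasoning)
open import Data.Product using (Σ; _,_; proj₁; proj₂)
open import Data.Sum using (_⊎_; inj₁; inj₂; [_,_]′; map₁; map₂)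
open import Data.Vec using (_∷_; there; tabulate)
open import Data.Vec.Properties using ([]=⇒lookup; lookup⇒[]=; lookup∘tabulate)
open import Data.Vec.Functional using (Vector; updateAt)
open import Data.Vec.Functional.Properties using (updateAt-updates; updateAt-minimal)
open import Function using (_∘_; const; id)
open import Function.Definitions using (Injective)
open import Relation.Binary.Construct.Closure.ReflexiveTransitive as Star
  using (Star; ε; _◅_; _◅◅_; reverse)
open import Relation.Binary.Construct.Closure.Symmetric as SymClosure using (SymClosure; fwd; bwd)
open import Relation.Binary.Definitions using (DecidableEquality)
open import Relation.Binary.PropositionalEquality as ≡ using (_≢_; refl; trans; cong)
open import Relation.Nullary using (¬_; Dec; yes; no)
open import Relation.Nullary.Decidable using (map′; _×-dec_; _⊎-dec_; ¬?; decidable-stable)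

module Walks {A : Set} (R : A → A → Set) where

  length : ∀ {x y} → Star R x y → ℕ
  length ε       = 0
  length (_ ◅ w) = suc (length w)

  vertexAt : ∀ {x y} (w : Star R x y) → Fin (suc (length w)) → A
  vertexAt {x} _       zero    = x
  vertexAt     (_ ◅ w) (suc i) = vertexAt w i

  vertexAt-step : ∀ {x y} (w : Star R x y) i j → toℕ j ≡ suc (toℕ i) →
                  R (vertexAt w i) (vertexAt w j)
  vertexAt-step (r ◅ w) zero    (suc zero)    _ = r
  vertexAt-step (r ◅ w) (suc i) (suc j)       e = vertexAt-step w i j (suc-injective e)
  vertexAt-step ε       zero    zero          ()
  vertexAt-step (r ◅ w) zero    zero          ()
  vertexAt-step (r ◅ w) zero    (suc (suc j)) ()
  vertexAt-step (r ◅ w) (suc i) zero          ()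

  vertexAt-last : ∀ {x y} (w : Star R x y) i → toℕ i ≡ length w → vertexAt w i ≡ y
  vertexAt-last ε       zero    _ = refl
  vertexAt-last (_ ◅ w) (suc i) e = vertexAt-last w i (suc-injective e)
  vertexAt-last (_ ◅ w) zero    ()

  _∈ʷ_ : ∀ {x y} → A → Star R x y → Set
  v ∈ʷ w = ∃ λ i → vertexAt w i ≡ v

  Simple : ∀ {x y} → Star R x y → Set
  Simple w = Injective _≡_ _≡_ (vertexAt w)

  ◅-simple : ∀ {x y z} {r : R x y} {w : Star R y z} → ¬ x ∈ʷ w → Simple w → Simple (r ◅ w)
  ◅-simple x∉w simple {zero}  {zero}  _    = refl
  ◅-simple x∉w simple {zero}  {suc j} x≡wⱼ = ⊥-elim (x∉w (j , ≡.sym x≡wⱼ))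
  ◅-simple x∉w simple {suc i} {zero}  wᵢ≡x = ⊥-elim (x∉w (i , wᵢ≡x))
  ◅-simple x∉w simple {suc i} {suc j} wᵢ≡wⱼ = cong suc (simple wᵢ≡wⱼ)

  drop : ∀ {x y} (w : Star R x y) i → Star R (vertexAt w i) y
  drop w       zero    = w
  drop (_ ◅ w) (suc i) = drop w i

  drop-simple : ∀ {x y} (w : Star R x y) i → Simple w → Simple (drop w i)
  drop-simple w       zero    simple = simple
  drop-simple (_ ◅ w) (suc i) simple = drop-simple w i (Fin.suc-injective ∘ simple)

  loopErase : DecidableEquality A → ∀ {x y} → Star R x y → Σ (Star R x y) Simple
  loopErase _≟ᴬ_ ε = ε , λ { {zero} {zero} _ → refl }
  loopErase _≟ᴬ_ {x} (r ◅ w) with loopErase _≟ᴬ_ w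
  ... | w′ , simple with any? (λ i → vertexAt w′ i ≟ᴬ x)
  ...   | yes (i , refl) = drop w′ i , drop-simple w′ i simple
  ...   | no x∉w′        = r ◅ w′ , ◅-simple x∉w′ simple

  chain : ∀ k (f : Fin (suc k) → A) → (∀ i → R (f (inject₁ i)) (f (suc i))) →
          Star R (f zero) (f (fromℕ k))
  chain zero    f steps = ε
  chain (suc k) f steps = steps zero ◅ chain k (f ∘ suc) (steps ∘ suc)

SameEnds : ∀ {n} → Fin n → Fin n → Fin n → Fin n → Set
SameEnds x y u v = (x ≡ u × y ≡ v) ⊎ (x ≡ v × y ≡ u)

SameEnds-swap : ∀ {n} {x y u v : Fin n} → SameEnds x y u v → SameEnds y x u v
SameEnds-swap (inj₁ (x≡u , y≡v)) = inj₂ (y≡v , x≡u)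
SameEnds-swap (inj₂ (x≡v , y≡u)) = inj₁ (y≡u , x≡v)

SameEnds-comm : ∀ {n} {x y u v : Fin n} → SameEnds x y u v → SameEnds u v x y
SameEnds-comm (inj₁ (x≡u , y≡v)) = inj₁ (≡.sym x≡u , ≡.sym y≡v)
SameEnds-comm (inj₂ (x≡v , y≡u)) = inj₂ (≡.sym y≡u , ≡.sym x≡v)

sameEnds? : ∀ {n} (x y u v : Fin n) → Dec (SameEnds x y u v)
sameEnds? x y u v = ((x ≟ u) ×-dec (y ≟ v)) ⊎-dec ((x ≟ v) ×-dec (y ≟ u))

module _ {n} (G : Graph n) {R : Fin n → Fin n → Set} (R⇒Adj : ∀ {x y} → R x y → Adj G x y) where
  open Walks R

  module _ {u x y v} (r₁ : R u x) (r₂ : R x y) (w : Star R y v)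
           (simple : Simple (r₁ ◅ r₂ ◅ w)) (vu : Adj G v u) where

    private
      closed : Fin (3 + length w) → Fin n
      closed = vertexAt (r₁ ◅ r₂ ◅ w)

      closed-step : ∀ i j → CycSucc i j → R (closed i) (closed j) ⊎ (closed i ≡ v × closed j ≡ u)
      closed-step i j       (inj₁ j≡1+i)         = inj₁ (vertexAt-step (r₁ ◅ r₂ ◅ w) i j j≡1+i)
      closed-step i zero    (inj₂ (1+i≡3+k , _)) =
        inj₂ (vertexAt-last (r₁ ◅ r₂ ◅ w) i (suc-injective 1+i≡3+k) , refl)
      closed-step i (suc _) (inj₂ (_ , ()))

      closing-edge : ∀ {p q} → p ≡ v × q ≡ u → Adj G p q
      closing-edge (p≡v , q≡u) = ≡.subst₂ (Adj G) (≡.sym p≡v) (≡.sym q≡u) vu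

    closeCycle : Cycle G
    closeCycle = record
      { m     = length w
      ; vs    = closed
      ; inj   = simple
      ; edges = λ i j i→j → [ R⇒Adj , closing-edge ]′ (closed-step i j i→j)
      }

    closeCycle-edge : ∀ {p q} → CycleEdge closeCycle p q → (R p q ⊎ R q p) ⊎ SameEnds p q u v
    closeCycle-edge (i , j , i→j , ends) with closed-step i j i→j | ends
    ... | inj₁ r         | inj₁ (refl , refl) = inj₁ (inj₁ r)
    ... | inj₁ r         | inj₂ (refl , refl) = inj₁ (inj₂ r)
    ... | inj₂ (iv , ju) | inj₁ (ip , jq)     = inj₂ (inj₂ (trans (≡.sym ip) iv , trans (≡.sym jq) ju))
    ... | inj₂ (iv , ju) | inj₂ (iq , jp)     = inj₂ (inj₁ (trans (≡.sym jp) ju , trans (≡.sym iq) iv))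

record SpanningTree {n} (R : Fin n → Fin n → Set) (root : Fin n) : Set where
  field
    parent       : Fin n → Fin n
    depth        : Fin n → ℕ
    parent-edge  : ∀ {v} → v ≢ root → R (parent v) v
    depth-parent : ∀ {v} → v ≢ root → depth v ≡ suc (depth (parent v))

  Parent : Fin n → Fin n → Set
  Parent x y = x ≢ root × parent x ≡ y

  TreeEdge : Fin n → Fin n → Set
  TreeEdge = SymClosure Parent

  treeEdge? : ∀ x y → Dec (TreeEdge x y)
  treeEdge? x y =
    map′ [ fwd , bwd ]′ (λ { (fwd p) → inj₁ p ; (bwd p) → inj₂ p }) (parent? x y ⊎-dec parent? y x)
    where
    parent? : ∀ x y → Dec (Parent x y)
    parent? x y = ¬? (x ≟ root) ×-dec (parent x ≟ y)

  pathToRoot : ∀ x → Star Parent x root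
  pathToRoot x = climb (depth x) x refl
    where
    climb : ∀ d x → depth x ≡ d → Star Parent x root
    climb d x _ with x ≟ root
    climb d       x _       | yes refl = ε
    climb zero    x depth≡0 | no x≢root with trans (≡.sym (depth-parent x≢root)) depth≡0
    ... | ()
    climb (suc d) x depth≡d | no x≢root = (x≢root , refl) ◅ climb d (parent x)
      (suc-injective (trans (≡.sym (depth-parent x≢root)) depth≡d))

module _ {n} {R : Fin n → Fin n → Set} {root : Fin n} where

  private
    Attached : Vector Bool n → Vector (Fin n) n → Vector ℕ n → Fin n → Set
    Attached member parent depth v =
      member (parent v) ≡ true × R (parent v) v × depth v ≡ suc (depth (parent v))

    record PartialTree : Set where
      field
        member : Vector Bool n
        parent : Vector (Fin n) n
        depth  : Vector ℕ n
        valid  : ∀ v → member v ≡ true → v ≡ root ⊎ Attached member parent depth v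
    open PartialTree

    _⊑_ : PartialTree → PartialTree → Set
    s ⊑ t = ∀ {v} → member s v ≡ true → member t v ≡ true

    Extension : PartialTree → Fin n → Set
    Extension s v = Σ PartialTree λ t → s ⊑ t × member t v ≡ true

    -- The tree is grown along a walk from the root to each vertex in turn; a vertex is attached
    -- to its predecessor on the walk the first time it is reached.
    seed : PartialTree
    seed = record
      { member = updateAt (const false) root (const true)
      ; parent = id
      ; depth  = const 0
      ; valid  = rootOnly
      }
      where
      rootOnly : ∀ v → updateAt (const false) root (const true) v ≡ true →
                 v ≡ root ⊎ Attached (updateAt (const false) root (const true)) id (const 0) v
      rootOnly v v∈ with v ≟ root
      ... | yes v≡root = inj₁ v≡root
      ... | no  v≢root with trans (≡.sym (updateAt-minimal v root (const false) v≢root)) v∈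
      ...   | ()

    seed-root : member seed root ≡ true
    seed-root = updateAt-updates root (const false)

    attach : ∀ s {x y} → member s x ≡ true → R x y → Extension s y
    attach s {x} {y} x∈s xy with member s y in y-membership
    ... | true  = s , id , y-membership
    ... | false = t , growing , updateAt-updates y (member s)
      where
      outside-y : ∀ {v} → member s v ≡ true → v ≢ y
      outside-y v∈s refl with trans (≡.sym v∈s) y-membership
      ... | ()

      member′ : Vector Bool n
      member′ = updateAt (member s) y (const true)

      parent′ : Vector (Fin n) n
      parent′ = updateAt (parent s) y (const x)

      depth′ : Vector ℕ n
      depth′ = updateAt (depth s) y (const (suc (depth s x)))

      growing : ∀ {v} → member s v ≡ true → member′ v ≡ true
      growing {v} v∈s = trans (updateAt-minimal v y (member s) (outside-y v∈s)) v∈s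

      depth′-unchanged : ∀ {v} → member s v ≡ true → depth′ v ≡ depth s v
      depth′-unchanged {v} v∈s = updateAt-minimal v y (depth s) (outside-y v∈s)

      attached : ∀ {v p} → parent′ v ≡ p → member′ p ≡ true → R p v → depth′ v ≡ suc (depth′ p) →
                 Attached member′ parent′ depth′ v
      attached refl p∈ pv depth-v = p∈ , pv , depth-v

      valid′ : ∀ v → member′ v ≡ true → v ≡ root ⊎ Attached member′ parent′ depth′ v
      valid′ v v∈ with v ≟ y
      ... | yes refl = inj₂ (attached (updateAt-updates y (parent s)) (growing x∈s) xy (begin
        depth′ y          ≡⟨ updateAt-updates y (depth s) ⟩
        suc (depth s x)   ≡⟨ cong suc (depth′-unchanged x∈s) ⟨
        suc (depth′ x)    ∎))
        where open ≡.≡-Reasoning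
      ... | no v≢y with valid s v (trans (≡.sym (updateAt-minimal v y (member s) v≢y)) v∈)
      ...   | inj₁ v≡root = inj₁ v≡root
      ...   | inj₂ (p∈s , pv , depth-v) =
        inj₂ (attached (updateAt-minimal v y (parent s) v≢y) (growing p∈s) pv (begin
          depth′ v                   ≡⟨ updateAt-minimal v y (depth s) v≢y ⟩
          depth s v                  ≡⟨ depth-v ⟩
          suc (depth s (parent s v)) ≡⟨ cong suc (depth′-unchanged p∈s) ⟨
          suc (depth′ (parent s v))  ∎))
        where open ≡.≡-Reasoning

      t : PartialTree
      t = record { member = member′ ; parent = parent′ ; depth = depth′ ; valid = valid′ }

    growAlong : ∀ s {x z} → member s x ≡ true → Star R x z → Extension s z
    growAlong s x∈s ε = s , id , x∈s
    growAlong s x∈s (xy ◅ w) with attach s x∈s xy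
    ... | t , s⊑t , y∈t with growAlong t y∈t w
    ...   | u , t⊑u , z∈u = u , t⊑u ∘ s⊑t , z∈u

    growAll : (∀ v → Star R root v) → ∀ s → member s root ≡ true → (vs : List (Fin n)) →
              Σ PartialTree λ t → s ⊑ t × All (λ v → member t v ≡ true) vs
    growAll reach s root∈s []       = s , id , []
    growAll reach s root∈s (v ∷ vs) with growAlong s root∈s (reach v)
    ... | t , s⊑t , v∈t with growAll reach t (s⊑t root∈s) vs
    ...   | u , t⊑u , vs∈u = u , t⊑u ∘ s⊑t , t⊑u v∈t ∷ vs∈u

  spanningTree : (∀ v → Star R root v) → SpanningTree R root
  spanningTree reach = record
    { parent       = parent t
    ; depth        = depth t
    ; parent-edge  = proj₁ ∘ proj₂ ∘ nonRoot
    ; depth-parent = proj₂ ∘ proj₂ ∘ nonRoot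
    }
    where
    grown : Σ PartialTree λ t → seed ⊑ t × All (λ v → member t v ≡ true) (allFin n)
    grown = growAll reach seed seed-root (allFin n)

    t : PartialTree
    t = proj₁ grown

    nonRoot : ∀ {v} → v ≢ root → Attached (member t) (parent t) (depth t) v
    nonRoot {v} v≢root with valid t v (All.lookup (proj₂ (proj₂ grown)) (∈-allFin v))
    ... | inj₁ v≡root = ⊥-elim (v≢root v≡root)
    ... | inj₂ p      = p

module _ {n} (G : Graph n) {R : Fin n → Fin n → Set} (R⇒Adj : ∀ {x y} → R x y → Adj G x y)
         {root : Fin n} (T : SpanningTree R root) where
  open SpanningTree T

  treeEdge⇒Adj : ∀ {x y} → TreeEdge x y → Adj G x y
  treeEdge⇒Adj = SymClosure.fold (Graph.sym G) λ
    { (x≢root , refl) → Graph.sym G (R⇒Adj (parent-edge x≢root)) }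

  nonTreeEdge⇒cycle : ∀ {u v} → Adj G u v → ¬ TreeEdge u v →
                      Σ (Cycle G) λ D → ∀ {x y} → CycleEdge D x y → TreeEdge x y ⊎ SameEnds x y u v
  nonTreeEdge⇒cycle {u} {v} uv ¬uv
    with Walks.loopErase TreeEdge _≟_ (Star.map fwd (pathToRoot u) ◅◅ reverse bwd (pathToRoot v))
  ... | ε , _             = ⊥-elim (Graph.irrefl G uv)
  ... | e ◅ ε , _         = ⊥-elim (¬uv e)
  ... | e₁ ◅ e₂ ◅ w , simple =
    closeCycle G treeEdge⇒Adj e₁ e₂ w simple (Graph.sym G uv) ,
    map₁ [ id , SymClosure.symmetric Parent ]′ ∘
      closeCycle-edge G treeEdge⇒Adj e₁ e₂ w simple (Graph.sym G uv)

∈-tabulate⁺ : ∀ {n} (f : Fin n → Bool) {x} → f x ≡ true → x ∈ tabulate f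
∈-tabulate⁺ f {x} fx = lookup⇒[]= x (tabulate f) (trans (lookup∘tabulate f x) fx)

∈-tabulate⁻ : ∀ {n} (f : Fin n → Bool) {x} → x ∈ tabulate f → f x ≡ true
∈-tabulate⁻ f {x} x∈ = trans (≡.sym (lookup∘tabulate f x)) ([]=⇒lookup x∈)

∈-∁tabulate⁻ : ∀ {n} (f : Fin n → Bool) {x} → x ∈ ∁ (tabulate f) → f x ≡ false
∈-∁tabulate⁻ f x∈ = ¬-not (x∈∁p⇒x∉p x∈ ∘ ∈-tabulate⁺ f)

x∉p-x : ∀ {n} (p : Subset n) x → x ∉ p - x
x∉p-x (s ∷ p) zero    ()
x∉p-x (s ∷ p) (suc x) (there x∈) = x∉p-x p x x∈

x∈p-y⇒x≢y : ∀ {n} {p : Subset n} {x y} → x ∈ p - y → x ≢ y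
x∈p-y⇒x≢y {p = p} {x} x∈ refl = x∉p-x p x x∈

∣p∪⁅x⁆∣≤1+∣p∣ : ∀ {n} (p : Subset n) x → ∣ p ∪ ⁅ x ⁆ ∣ ≤ suc ∣ p ∣
∣p∪⁅x⁆∣≤1+∣p∣ (inside  ∷ p) zero    rewrite ∪-identityʳ p = n≤1+n (suc ∣ p ∣)
∣p∪⁅x⁆∣≤1+∣p∣ (outside ∷ p) zero    rewrite ∪-identityʳ p = ≤-refl
∣p∪⁅x⁆∣≤1+∣p∣ (inside  ∷ p) (suc x) = s≤s (∣p∪⁅x⁆∣≤1+∣p∣ p x)
∣p∪⁅x⁆∣≤1+∣p∣ (outside ∷ p) (suc x) = ∣p∪⁅x⁆∣≤1+∣p∣ p x

∣p∣≤1+∣p-x∣ : ∀ {n} (p : Subset n) x → ∣ p ∣ ≤ suc ∣ p - x ∣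
∣p∣≤1+∣p-x∣ p x = ≤-trans (p⊆q⇒∣p∣≤∣q∣ p⊆[p-x]∪⁅x⁆) (∣p∪⁅x⁆∣≤1+∣p∣ (p - x) x)
  where
  p⊆[p-x]∪⁅x⁆ : p ⊆ (p - x) ∪ ⁅ x ⁆
  p⊆[p-x]∪⁅x⁆ {y} y∈p with y ≟ x
  ... | yes refl = x∈p∪q⁺ (inj₂ (x∈⁅x⁆ x))
  ... | no  y≢x  = x∈p∪q⁺ (inj₁ (x∈p∧x≢y⇒x∈p-y y∈p y≢x))

x∉p⇒∣p∣≤∣p-x∣ : ∀ {n} {p : Subset n} {x} → x ∉ p → ∣ p ∣ ≤ ∣ p - x ∣
x∉p⇒∣p∣≤∣p-x∣ {p = p} {x} x∉p =
  p⊆q⇒∣p∣≤∣q∣ {p = p} {q = p - x} λ y∈p → x∈p∧x≢y⇒x∈p-y y∈p λ { refl → x∉p y∈p }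

∣p∣+∣∁p∣≡n : ∀ {n} (p : Subset n) → ∣ p ∣ + ∣ ∁ p ∣ ≡ n
∣p∣+∣∁p∣≡n p = trans (cong (∣ p ∣ +_) (∣∁p∣≡n∸∣p∣ p)) (m+[n∸m]≡n (∣p∣≤n p))

n≤1+∣p-x∣+∣∁p-x∣ : ∀ {n} (p : Subset n) x → n ≤ suc (∣ p - x ∣ + ∣ ∁ p - x ∣)
n≤1+∣p-x∣+∣∁p-x∣ {n} p x with x ∈? p
... | yes x∈p = begin
  n                                ≡⟨ ∣p∣+∣∁p∣≡n p ⟨
  ∣ p ∣ + ∣ ∁ p ∣                  ≤⟨ +-mono-≤ (∣p∣≤1+∣p-x∣ p x) (x∉p⇒∣p∣≤∣p-x∣ (x∈p⇒x∉∁p x∈p)) ⟩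
  suc (∣ p - x ∣ + ∣ ∁ p - x ∣)    ∎
  where open ≤-Reasoning
... | no x∉p = begin
  n                                ≡⟨ ∣p∣+∣∁p∣≡n p ⟨
  ∣ p ∣ + ∣ ∁ p ∣                  ≤⟨ +-mono-≤ (x∉p⇒∣p∣≤∣p-x∣ x∉p) (∣p∣≤1+∣p-x∣ (∁ p) x) ⟩
  ∣ p - x ∣ + suc ∣ ∁ p - x ∣      ≡⟨ +-suc ∣ p - x ∣ ∣ ∁ p - x ∣ ⟩
  suc (∣ p - x ∣ + ∣ ∁ p - x ∣)    ∎
  where open ≤-Reasoning

n/2+n/2≤n : ∀ n → n / 2 + n / 2 ≤ n
n/2+n/2≤n n = begin
  n / 2 + n / 2        ≡⟨ cong (n / 2 +_) (+-identityʳ (n / 2)) ⟨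
  2 * (n / 2)          ≡⟨ *-comm 2 (n / 2) ⟩
  n / 2 * 2            ≤⟨ m/n*n≤m n 2 ⟩
  n                    ∎
  where open ≤-Reasoning

n≤1+x+y⇒n/2≤x⊎n/2≤y : ∀ {n x y} → n ≤ suc (x + y) → n / 2 ≤ x ⊎ n / 2 ≤ y
n≤1+x+y⇒n/2≤x⊎n/2≤y {n} {x} {y} n≤ with n / 2 ≤? x | n / 2 ≤? y
... | yes h≤x | _       = inj₁ h≤x
... | no  _   | yes h≤y = inj₂ h≤y
... | no  h≰x | no  h≰y = ⊥-elim (1+n≰n (begin
  suc (suc (x + y))  ≡⟨ +-suc (suc x) y ⟨
  suc x + suc y      ≤⟨ +-mono-≤ (≰⇒> h≰x) (≰⇒> h≰y) ⟩
  n / 2 + n / 2      ≤⟨ n/2+n/2≤n n ⟩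
  n                  ≤⟨ n≤ ⟩
  suc (x + y)        ∎))
  where open ≤-Reasoning

Independent : ∀ {n} → Graph n → Subset n → Set
Independent G I = ∀ {u v} → u ∈ I → v ∈ I → ¬ Adj G u v

module _ {n} (G : Graph n) where

  independent∧dominating⇒minimal : ∀ {D} → Independent G D → Dominating G D → MinimalDominating G D
  independent∧dominating⇒minimal independent dominating = dominating , smaller
    where
    smaller : ∀ D′ → D′ ⊂ _ → ¬ Dominating G D′
    smaller D′ (D′⊆D , x , x∈D , x∉D′) dominating′ with dominating′ x
    ... | inj₁ x∈D′             = x∉D′ x∈D′
    ... | inj₂ (u , u∈D′ , ux) = independent (D′⊆D u∈D′) x∈D ux

  monochromatic-independent : ∀ (colour : Fin n → Bool) a →
    (∀ {x y} → Adj G x y → x ≢ a → y ≢ a → colour x ≢ colour y) →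
    ∀ {β} (S : Subset n) → (∀ {x} → x ∈ S → colour x ≡ β) → Independent G (S - a)
  monochromatic-independent colour a proper S mono u∈ v∈ uv =
    proper uv (x∈p-y⇒x≢y u∈) (x∈p-y⇒x≢y v∈)
      (trans (mono (p─q⊆p S ⁅ a ⁆ u∈)) (≡.sym (mono (p─q⊆p S ⁅ a ⁆ v∈))))

  module _ (adj? : ∀ x y → Dec (Adj G x y)) where

    Dominated : Subset n → Fin n → Set
    Dominated D v = v ∈ D ⊎ ∃ λ u → u ∈ D × Adj G u v

    dominated? : ∀ D v → Dec (Dominated D v)
    dominated? D v = (v ∈? D) ⊎-dec any? (λ u → (u ∈? D) ×-dec adj? u v)

    dominated-mono : ∀ {D D′ v} → D ⊆ D′ → Dominated D v → Dominated D′ v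
    dominated-mono D⊆D′ (inj₁ v∈D)             = inj₁ (D⊆D′ v∈D)
    dominated-mono D⊆D′ (inj₂ (u , u∈D , uv)) = inj₂ (u , D⊆D′ u∈D , uv)

    extendIndependent : ∀ I → Independent G I → (vs : List (Fin n)) →
                        Σ (Subset n) λ J → I ⊆ J × Independent G J × All (Dominated J) vs
    extendIndependent I independent []       = I , id , independent , []
    extendIndependent I independent (v ∷ vs) with extendIndependent I independent vs
    ... | J , I⊆J , independentJ , dominatedJ with dominated? J v
    ...   | yes v-dominated = J , I⊆J , independentJ , v-dominated ∷ dominatedJ
    ...   | no  v-free      =
      J ∪ ⁅ v ⁆ , p⊆p∪q ⁅ v ⁆ ∘ I⊆J , independent′ ,
      inj₁ (x∈p∪q⁺ (inj₂ (x∈⁅x⁆ v))) ∷ All.map (dominated-mono (p⊆p∪q ⁅ v ⁆)) dominatedJ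
      where
      ∈J∪⁅v⁆ : ∀ {x} → x ∈ J ∪ ⁅ v ⁆ → x ∈ J ⊎ x ≡ v
      ∈J∪⁅v⁆ = map₂ (x∈⁅y⁆⇒x≡y v) ∘ x∈p∪q⁻ J ⁅ v ⁆

      independent′ : Independent G (J ∪ ⁅ v ⁆)
      independent′ x∈ y∈ xy with ∈J∪⁅v⁆ x∈ | ∈J∪⁅v⁆ y∈
      ... | inj₁ x∈J | inj₁ y∈J = independentJ x∈J y∈J xy
      ... | inj₁ x∈J | inj₂ refl = v-free (inj₂ (_ , x∈J , xy))
      ... | inj₂ refl | inj₁ y∈J = v-free (inj₂ (_ , y∈J , Graph.sym G xy))
      ... | inj₂ refl | inj₂ refl = Graph.irrefl G xy

    independent⊆minimalDominating : ∀ I → Independent G I → ∃ λ D → I ⊆ D × MinimalDominating G D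
    independent⊆minimalDominating I independent with extendIndependent I independent (allFin n)
    ... | D , I⊆D , independentD , dominatedD =
      D , I⊆D , independent∧dominating⇒minimal independentD λ v → All.lookup dominatedD (∈-allFin v)

isEven : ℕ → Bool
isEven zero    = true
isEven (suc k) = not (isEven k)

module UnicyclicProperties {n} (G : Graph n) (connected : Connected G) (C : Cycle G)
                           (unique : ∀ (C D : Cycle G) → SameCycle C D) where

  a b : Fin n
  a = vs C zero
  b = vs C (fromℕ (2 + m C))

  last→first : CycSucc (fromℕ (2 + m C)) zero
  last→first = inj₂ (cong suc (toℕ-fromℕ (2 + m C)) , refl)

  ab∈C : CycleEdge C a b
  ab∈C = fromℕ (2 + m C) , zero , last→first , inj₂ (refl , refl)

  Adj∖ab : Fin n → Fin n → Set
  Adj∖ab x y = Adj G x y × ¬ SameEnds x y a b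

  Adj∖ab-sym : ∀ {x y} → Adj∖ab x y → Adj∖ab y x
  Adj∖ab-sym (xy , ¬ab) = Graph.sym G xy , ¬ab ∘ SameEnds-swap

  arc : Star Adj∖ab a b
  arc = Walks.chain Adj∖ab (2 + m C) (vs C) λ i →
          edges C (inject₁ i) (suc i) (inj₁ (cong suc (≡.sym (toℕ-inject₁ i)))) , notAB i
    where
    notAB : ∀ i → ¬ SameEnds (vs C (inject₁ i)) (vs C (suc i)) a b
    notAB i (inj₁ (i≡first , 1+i≡last)) with Fin.suc-injective (inj C 1+i≡last)
    ... | refl with inj C i≡first
    ...   | ()
    notAB i (inj₂ (i≡last , _)) = fromℕ≢inject₁ (≡.sym (inj C i≡last))

  walk∖ab : ∀ {x y} → Walk G x y → Star Adj∖ab x y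
  walk∖ab here = ε
  walk∖ab (step {u} {v} uv w) with sameEnds? u v a b
  ... | no  ¬ab                = (uv , ¬ab) ◅ walk∖ab w
  ... | yes (inj₁ (refl , refl)) = arc ◅◅ walk∖ab w
  ... | yes (inj₂ (refl , refl)) = reverse Adj∖ab-sym arc ◅◅ walk∖ab w

  tree : SpanningTree Adj∖ab a
  tree = spanningTree (λ v → walk∖ab (connected a v))

  open SpanningTree tree

  treeEdge⇒Adj∖ab : ∀ {x y} → TreeEdge x y → Adj∖ab x y
  treeEdge⇒Adj∖ab = SymClosure.fold Adj∖ab-sym λ { (x≢a , refl) → Adj∖ab-sym (parent-edge x≢a) }

  -- The cycle closed by a non-tree edge uv must be C, so it contains ab; but ab is neither a
  -- tree edge nor uv.
  Adj∖ab⇒treeEdge : ∀ {u v} → Adj∖ab u v → TreeEdge u v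
  Adj∖ab⇒treeEdge {u} {v} (uv , ¬ab) = decidable-stable (treeEdge? u v) λ ¬tree →
    let D , D-edge = nonTreeEdge⇒cycle G proj₁ tree uv ¬tree in
    [ (λ ab → proj₂ (treeEdge⇒Adj∖ab ab) (inj₁ (refl , refl))) , ¬ab ∘ SameEnds-comm ]′
      (D-edge (proj₁ (unique C D a b) ab∈C))

  adj? : ∀ x y → Dec (Adj G x y)
  adj? x y =
    map′ [ fromAB , treeEdge⇒Adj G proj₁ tree ]′ toTree (sameEnds? x y a b ⊎-dec treeEdge? x y)
    where
    fromAB : SameEnds x y a b → Adj G x y
    fromAB (inj₁ (refl , refl)) = Graph.sym G (edges C _ _ last→first)
    fromAB (inj₂ (refl , refl)) = edges C _ _ last→first

    toTree : Adj G x y → SameEnds x y a b ⊎ TreeEdge x y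
    toTree xy with sameEnds? x y a b
    ... | yes ab  = inj₁ ab
    ... | no  ¬ab = inj₂ (Adj∖ab⇒treeEdge (xy , ¬ab))

  colour : Fin n → Bool
  colour = isEven ∘ depth

  treeEdge⇒colour≢ : ∀ {x y} → TreeEdge x y → colour x ≢ colour y
  treeEdge⇒colour≢ (fwd (x≢a , refl)) same = not-¬ same (cong isEven (depth-parent x≢a))
  treeEdge⇒colour≢ (bwd (y≢a , refl)) same = not-¬ (≡.sym same) (cong isEven (depth-parent y≢a))

  colour-proper : ∀ {x y} → Adj G x y → x ≢ a → y ≢ a → colour x ≢ colour y
  colour-proper xy x≢a y≢a = treeEdge⇒colour≢ (Adj∖ab⇒treeEdge (xy , λ
    { (inj₁ (x≡a , _)) → x≢a x≡a
    ; (inj₂ (_ , y≡a)) → y≢a y≡a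
    }))

  largeIndependentSet : ∃ λ I → Independent G I × n / 2 ≤ ∣ I ∣
  largeIndependentSet with n≤1+x+y⇒n/2≤x⊎n/2≤y (n≤1+∣p-x∣+∣∁p-x∣ (tabulate colour) a)
  ... | inj₁ n/2≤ = tabulate colour - a ,
    monochromatic-independent G colour a colour-proper _ (∈-tabulate⁻ colour) , n/2≤
  ... | inj₂ n/2≤ = ∁ (tabulate colour) - a ,
    monochromatic-independent G colour a colour-proper _ (∈-∁tabulate⁻ colour) , n/2≤

  largeMinimalDominatingSet : ∃ λ D → MinimalDominating G D × n / 2 ≤ ∣ D ∣
  largeMinimalDominatingSet with largeIndependentSet
  ... | I , independent , n/2≤∣I∣ with independent⊆minimalDominating G adj? I independent
  ...   | D , I⊆D , minimal = D , minimal , ≤-trans n/2≤∣I∣ (p⊆q⇒∣p∣≤∣q∣ I⊆D)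

lemma10 : ∀ (n : ℕ) (G : Graph n) → Unicyclic G →
    ((n % 2 ≡ 0) → ∃ λ D → MinimalDominating G D × (n / 2 ≤ ∣ D ∣)) ×
    ((n % 2 ≡ 1) → ∃ λ D → MinimalDominating G D × ((n ∸ 1) / 2 ≤ ∣ D ∣))
lemma10 n G (connected , C , unique)
  with UnicyclicProperties.largeMinimalDominatingSet G connected C unique
... | D , minimal , n/2≤∣D∣ =
  (λ _ → D , minimal , n/2≤∣D∣) , (λ _ → D , minimal , ≤-trans (/-monoˡ-≤ 2 (m∸n≤m n 1)) n/2≤∣D∣)
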